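{- Let $G=(V,E)$ and $G'=(V',E')$ be graphs and let $\tau:V\to V'$ be an embedding (an injective map) of their shortest-path metrics. Then for any $S\subseteq V$, $$\mathrm{tour}_G(S)\le\|\tau^{ -1}\|_{\mathrm{Lip}}\cdot\mathrm{tour}_{G'}(\tau(S)).$$
   Context: For a graph $H$ with shortest-path distance $d_H$ and $S\subseteq V(H)$, $\mathrm{tour}_H(S)=\max_{v\in S}\min_{W\in\mathcal{W}(v,S)}\mathrm{length}_H(W)$, where $\mathcal{W}(v,S)$ is the set of walks in $H$ starting at $v$ and visiting every vertex of $S$. For a map $\sigma$ between metric spaces $(X,d_X)\to(Y,d_Y)$, $\|\sigma\|_{\mathrm{Lip}}=\max_{x_1\ne x_2}\frac{d_Y(\sigma(x_1),\sigma(x_2))}{d_X(x_1,x_2)}$; here $\tau^{ -1}:\tau(V)\to V$ with the metrics $d_{G'}$ and $d_G$. -}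

module Defs where

open import Data.Nat using (ℕ; zero; suc; _≤_)
open import Data.Fin using (Fin)
open import Data.Fin.Subset using (Subset; _∈_)
open import Data.List using (List; []; _∷_)
import Data.List.Membership.Propositional as LM
open import Data.Product using (Σ; _×_; _,_)
open import Data.Sum using (_⊎_)
open import Data.Integer using (+_)
open import Data.Rational as ℚ using (ℚ; 0ℚ)
open import Relation.Nullary using (¬_)
open import Relation.Binary.PropositionalEquality using (_≡_; _≢_)

record Graph : Set₁ where
  field
    n      : ℕ
    Adj    : Fin n → Fin n → Set
    sym    : ∀ {u v} → Adj u v → Adj v u
    irrefl : ∀ {u} → ¬ Adj u u

Vertex : Graph → Set
Vertex G = Fin (Graph.n G)

data Walk (G : Graph) : Vertex G → Vertex G → Set where
  [_]  : (u : Vertex G) → Walk G u u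
  step : {u w v : Vertex G} → Graph.Adj G u w → Walk G w v → Walk G u v

length : {G : Graph} {u v : Vertex G} → Walk G u v → ℕ
length [ u ]      = 0
length (step _ W) = suc (length W)

vertices : {G : Graph} {u v : Vertex G} → Walk G u v → List (Vertex G)
vertices [ u ] = u ∷ []
vertices (step {u = u} _ W) = u ∷ vertices W

IsShortestPathMetric : (G : Graph) → (Vertex G → Vertex G → ℕ) → Set
IsShortestPathMetric G d =
  (∀ u v → Σ (Walk G u v) (λ W → length W ≡ d u v)) ×
  (∀ u v (W : Walk G u v) → d u v ≤ length W)

Visits : {G : Graph} {u v : Vertex G} → Walk G u v → (Vertex G → Set) → Set
Visits {G} W P = ∀ (x : Vertex G) → P x → x LM.∈ vertices W

IsMinTourFrom : (G : Graph) → (Vertex G → Set) → Vertex G → ℕ → Set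
IsMinTourFrom G P v m =
  Σ (Vertex G) (λ e → Σ (Walk G v e) (λ W → Visits W P × length W ≡ m)) ×
  (∀ (e : Vertex G) (W : Walk G v e) → Visits W P → m ≤ length W)

-- t = tour_G(P) = max_{v ∈ P} min_{W ∈ 𝒲(v,P)} length W   (convention: 0 for empty P)
IsTour : (G : Graph) → (Vertex G → Set) → ℕ → Set
IsTour G P t =
  (∀ v → P v → Σ ℕ (λ m → IsMinTourFrom G P v m × m ≤ t)) ×
  (Σ (Vertex G) (λ v → P v × IsMinTourFrom G P v t) ⊎
   ((∀ v → ¬ P v) × t ≡ 0))

-- a / b as a rational (b = 0 never occurs in our uses: junk value 0)
ratio : ℕ → ℕ → ℚ
ratio a zero    = 0ℚ
ratio a (suc b) = (+ a) ℚ./ suc b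

-- L = ‖τ⁻¹‖_Lip for τ⁻¹ : (τ(V), d') → (V, d), i.e.
-- L = max_{y₁ ≠ y₂ ∈ τ(V)} d(τ⁻¹ y₁, τ⁻¹ y₂) / d'(y₁, y₂),
-- written with y_i = τ x_i (τ injective, so y₁ ≠ y₂ iff x₁ ≠ x₂).
-- Convention 0 if there is no pair of distinct points.
IsLipNormInv : (G G' : Graph) → (Vertex G → Vertex G') →
               (Vertex G → Vertex G → ℕ) → (Vertex G' → Vertex G' → ℕ) → ℚ → Set
IsLipNormInv G G' τ d d' L =
  (∀ x₁ x₂ → x₁ ≢ x₂ → ratio (d x₁ x₂) (d' (τ x₁) (τ x₂)) ℚ.≤ L) ×
  (Σ (Vertex G) (λ x₁ → Σ (Vertex G) (λ x₂ →
      x₁ ≢ x₂ × ratio (d x₁ x₂) (d' (τ x₁) (τ x₂)) ≡ L)) ⊎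
   ((∀ (x₁ x₂ : Vertex G) → x₁ ≡ x₂) × L ≡ 0ℚ))

Image : {G G' : Graph} → (Vertex G → Vertex G') → Subset (Graph.n G) → Vertex G' → Set
Image {G} τ S y = Σ (Vertex G) (λ x → x ∈ S × τ x ≡ y)

ℕtoℚ : ℕ → ℚ
ℕtoℚ k = (+ k) ℚ./ 1

-- Follow a tour W' of G' through τ(S), keeping an anchor a in G.  Whenever W'
-- stands on an image point τ x, jump from the anchor to x along a shortest
-- path of G, of length d a x ≤ ‖τ⁻¹‖ · d'(τ a, τ x), and make x the new anchor.
-- The triangle inequality in G' bounds d'(τ a, τ x) by the portion of W'
-- walked since the last jump, so the lifted walk visits every x ∈ S and has
-- length at most ‖τ⁻¹‖ · length W'.
module Submission where

open import Defs
open import Data.Nat using (ℕ; suc; _+_; _*_; _≤_; z≤n)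
open import Data.Nat.Properties
open import Data.Nat.Tactic.RingSolver using (solve-∀)
open import Data.Nat.Coprimality using (Coprime)
open import Data.Fin.Subset using (Subset; _∈_)
import Data.Fin.Properties as Fin
open import Data.Integer as ℤ using (+_; -[1+_])
import Data.Integer.Properties as ℤ
open import Data.Rational as ℚ using (ℚ; mkℚ)
import Data.Rational.Properties as ℚ
open import Data.Rational.Unnormalised as ℚᵘ using (mkℚᵘ; *≤*; *≡*)
import Data.Rational.Unnormalised.Properties as ℚᵘ
open import Data.List.Membership.Propositional using () renaming (_∈_ to _∈ₗ_)
open import Data.List.Relation.Unary.Any using (here; there)
open import Data.Product using (_,_; proj₁; proj₂)
open import Data.Sum using (inj₁; inj₂)
open import Data.Empty using (⊥-elim)
open import Relation.Nullary using (yes; no)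
open import Relation.Binary.PropositionalEquality
open import Function.Definitions using (Injective)

module _ {G : Graph} where

  infixr 5 _++ʷ_

  _++ʷ_ : {u v w : Vertex G} → Walk G u v → Walk G v w → Walk G u w
  [ _ ]      ++ʷ W₂ = W₂
  step e W₁ ++ʷ W₂ = step e (W₁ ++ʷ W₂)

  length-++ʷ : {u v w : Vertex G} (W₁ : Walk G u v) (W₂ : Walk G v w) →
               length (W₁ ++ʷ W₂) ≡ length W₁ + length W₂
  length-++ʷ [ _ ]      W₂ = refl
  length-++ʷ (step e W₁) W₂ = cong suc (length-++ʷ W₁ W₂)

  ∈-++ʷʳ : {u v w x : Vertex G} (W₁ : Walk G u v) {W₂ : Walk G v w} →
           x ∈ₗ vertices W₂ → x ∈ₗ vertices (W₁ ++ʷ W₂)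
  ∈-++ʷʳ [ _ ]       x∈W₂ = x∈W₂
  ∈-++ʷʳ (step e W₁) x∈W₂ = there (∈-++ʷʳ W₁ x∈W₂)

  start-∈ : {u v : Vertex G} (W : Walk G u v) → u ∈ₗ vertices W
  start-∈ [ _ ]      = here refl
  start-∈ (step _ _) = here refl

  end-∈ : {u v : Vertex G} (W : Walk G u v) → v ∈ₗ vertices W
  end-∈ [ _ ]      = here refl
  end-∈ (step _ W) = there (end-∈ W)

  length≡0⇒≡ : {u v : Vertex G} (W : Walk G u v) → length W ≡ 0 → u ≡ v
  length≡0⇒≡ [ _ ] _ = refl

module ShortestPath {G : Graph} {d : Vertex G → Vertex G → ℕ}
                    (spm : IsShortestPathMetric G d) where

  geodesic : (u v : Vertex G) → Walk G u v
  geodesic u v = proj₁ (proj₁ spm u v)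

  length-geodesic : (u v : Vertex G) → length (geodesic u v) ≡ d u v
  length-geodesic u v = proj₂ (proj₁ spm u v)

  d≤length : {u v : Vertex G} (W : Walk G u v) → d u v ≤ length W
  d≤length = proj₂ spm _ _

  d-refl : (u : Vertex G) → d u u ≡ 0
  d-refl u = n≤0⇒n≡0 (d≤length [ u ])

  d≡0⇒≡ : {u v : Vertex G} → d u v ≡ 0 → u ≡ v
  d≡0⇒≡ {u} {v} duv≡0 = length≡0⇒≡ (geodesic u v) (trans (length-geodesic u v) duv≡0)

  d-edge : {u y w : Vertex G} → Graph.Adj G y w → d u w ≤ d u y + 1
  d-edge {u} {y} {w} e = begin
    d u w                                   ≤⟨ d≤length (geodesic u y ++ʷ step e [ w ]) ⟩
    length (geodesic u y ++ʷ step e [ w ])  ≡⟨ length-++ʷ (geodesic u y) (step e [ w ]) ⟩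
    length (geodesic u y) + 1               ≡⟨ cong (_+ 1) (length-geodesic u y) ⟩
    d u y + 1                               ∎
    where open ≤-Reasoning

-- lip says that τ⁻¹ is (k / D)-Lipschitz, with denominators cleared.
module Lifting (G G' : Graph) (τ : Vertex G → Vertex G') (τ-inj : Injective _≡_ _≡_ τ)
  {d : Vertex G → Vertex G → ℕ} {d' : Vertex G' → Vertex G' → ℕ}
  (spm : IsShortestPathMetric G d) (spm' : IsShortestPathMetric G' d')
  (D k : ℕ) (lip : ∀ x₁ x₂ → d x₁ x₂ * D ≤ k * d' (τ x₁) (τ x₂)) where

  open ShortestPath spm using (geodesic; length-geodesic)
  open ShortestPath spm' using () renaming (d-refl to d'-refl; d-edge to d'-edge)

  -- cost reads length walk ≤ (k / D) · (d'(τ a, y) − d'(τ target, y)), rearranged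
  -- to avoid both division and truncated subtraction.
  record Jump (a : Vertex G) (y : Vertex G') : Set where
    field
      target : Vertex G
      walk   : Walk G a target
      hits   : ∀ x → τ x ≡ y → x ≡ target
      cost   : length walk * D + k * d' (τ target) y ≤ k * d' (τ a) y

  jump : (a : Vertex G) (y : Vertex G') → Jump a y
  jump a y with Fin.any? (λ x → τ x Fin.≟ y)
  ... | yes (x , refl) = record
    { target = x
    ; walk   = geodesic a x
    ; hits   = λ _ → τ-inj
    ; cost   = begin
        length (geodesic a x) * D + k * d' (τ x) (τ x)
          ≡⟨ cong₂ (λ l m → l * D + k * m) (length-geodesic a x) (d'-refl (τ x)) ⟩
        d a x * D + k * 0
          ≡⟨ cong (λ m → d a x * D + m) (*-zeroʳ k) ⟩
        d a x * D + 0
          ≡⟨ +-identityʳ (d a x * D) ⟩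
        d a x * D
          ≤⟨ lip a x ⟩
        k * d' (τ a) (τ x)
          ∎
    }
    where open ≤-Reasoning
  ... | no y∉τV = record
    { target = a
    ; walk   = [ a ]
    ; hits   = λ x τx≡y → ⊥-elim (y∉τV (x , τx≡y))
    ; cost   = ≤-refl
    }

  record Lift (a : Vertex G) {y e : Vertex G'} (W' : Walk G' y e) : Set where
    field
      end    : Vertex G
      walk   : Walk G a end
      covers : ∀ x → τ x ∈ₗ vertices W' → x ∈ₗ vertices walk
      bound  : length walk * D ≤ k * (d' (τ a) y + length W')

  lift : (a : Vertex G) {y e : Vertex G'} (W' : Walk G' y e) → Lift a W'
  lift a {y} [ .y ] = record
    { end    = target
    ; walk   = walk
    ; covers = λ { x (here τx≡y) → subst (_∈ₗ vertices walk) (sym (hits x τx≡y)) (end-∈ walk) }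
    ; bound  = begin
        length walk * D                               ≤⟨ m≤m+n (length walk * D) _ ⟩
        length walk * D + k * d' (τ target) y         ≤⟨ cost ⟩
        k * d' (τ a) y                                ≡⟨ cong (k *_) (+-identityʳ (d' (τ a) y)) ⟨
        k * (d' (τ a) y + 0)                          ∎
    }
    where open Jump (jump a y)
          open ≤-Reasoning
  lift a {y} (step {w = w} e W'') = record
    { end    = Lift.end rest
    ; walk   = walk ++ʷ Lift.walk rest
    ; covers = λ
        { x (here τx≡y) → ∈-++ʷʳ walk (subst (_∈ₗ vertices (Lift.walk rest)) (sym (hits x τx≡y))
                                               (start-∈ (Lift.walk rest)))
        ; x (there τx∈W'') → ∈-++ʷʳ walk (Lift.covers rest x τx∈W'') }
    ; bound  = begin
        length (walk ++ʷ Lift.walk rest) * D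
          ≡⟨ cong (_* D) (length-++ʷ walk (Lift.walk rest)) ⟩
        (length walk + length (Lift.walk rest)) * D
          ≡⟨ *-distribʳ-+ D (length walk) (length (Lift.walk rest)) ⟩
        length walk * D + length (Lift.walk rest) * D
          ≤⟨ +-monoʳ-≤ (length walk * D) (Lift.bound rest) ⟩
        length walk * D + k * (d' (τ target) w + length W'')
          ≤⟨ +-monoʳ-≤ (length walk * D) (*-monoʳ-≤ k (+-monoˡ-≤ (length W'') (d'-edge e))) ⟩
        length walk * D + k * (d' (τ target) y + 1 + length W'')
          ≡⟨ regroup (length walk * D) k (d' (τ target) y) (length W'') ⟩
        (length walk * D + k * d' (τ target) y) + k * suc (length W'')
          ≤⟨ +-monoˡ-≤ (k * suc (length W'')) cost ⟩
        k * d' (τ a) y + k * suc (length W'')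
          ≡⟨ *-distribˡ-+ k (d' (τ a) y) (suc (length W'')) ⟨
        k * (d' (τ a) y + suc (length W''))
          ∎
    }
    where open Jump (jump a y)
          rest = lift target W''
          regroup : ∀ p k m n → p + k * (m + 1 + n) ≡ (p + k * m) + k * suc n
          regroup = solve-∀
          open ≤-Reasoning

  tour-bound : (S : Subset (Graph.n G)) {t t' : ℕ} →
               IsTour G (_∈ S) t → IsTour G' (Image {G} {G'} τ S) t' → t * D ≤ k * t'
  tour-bound S (_ , inj₂ (_ , refl)) _ = z≤n
  tour-bound S {t} {t'} (_ , inj₁ (v , v∈S , _ , t-minimal)) (tours' , _)
    with tours' (τ v) (v , v∈S , refl)
  ... | m' , ((_ , W' , visits' , length-W'≡m') , _) , m'≤t' = begin
    t * D                                  ≤⟨ *-monoˡ-≤ D (t-minimal _ walk visitsS) ⟩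
    length walk * D                        ≤⟨ bound ⟩
    k * (d' (τ v) (τ v) + length W')       ≡⟨ cong (λ m → k * (m + length W')) (d'-refl (τ v)) ⟩
    k * length W'                          ≡⟨ cong (k *_) length-W'≡m' ⟩
    k * m'                                 ≤⟨ *-monoʳ-≤ k m'≤t' ⟩
    k * t'                                 ∎
    where open Lift (lift v W')
          visitsS : ∀ x → x ∈ S → x ∈ₗ vertices walk
          visitsS x x∈S = covers x (visits' (τ x) (x , x∈S , refl))
          open ≤-Reasoning

mkℚᵘ-+-≤⇒ : ∀ {a b c e} → mkℚᵘ (+ a) c ℚᵘ.≤ mkℚᵘ (+ b) e → a * suc e ≤ b * suc c
mkℚᵘ-+-≤⇒ {a} {b} {c} {e} (*≤* a*e≤b*c) =
  ℤ.drop‿+≤+ (subst₂ ℤ._≤_ (sym (ℤ.pos-* a (suc e))) (sym (ℤ.pos-* b (suc c))) a*e≤b*c)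

mkℚᵘ-+-≤⁺ : ∀ {a b c e} → a * suc e ≤ b * suc c → mkℚᵘ (+ a) c ℚᵘ.≤ mkℚᵘ (+ b) e
mkℚᵘ-+-≤⁺ {a} {b} {c} {e} a*e≤b*c =
  *≤* (subst₂ ℤ._≤_ (ℤ.pos-* a (suc e)) (ℤ.pos-* b (suc c)) (ℤ.+≤+ a*e≤b*c))

ratio-≤-mkℚ⇒ : ∀ a b {k q} .{c : Coprime k (suc q)} →
               ratio a (suc b) ℚ.≤ mkℚ (+ k) q c → a * suc q ≤ k * suc b
ratio-≤-mkℚ⇒ a b ratio≤L =
  mkℚᵘ-+-≤⇒ (ℚᵘ.≤-respˡ-≃ (ℚ.toℚᵘ-fromℚᵘ (mkℚᵘ (+ a) b)) (ℚ.toℚᵘ-mono-≤ ratio≤L))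

ℕtoℚ-≤-mkℚ* : ∀ {k q} .{c : Coprime k (suc q)} t t' →
              t * suc q ≤ k * t' → ℕtoℚ t ℚ.≤ mkℚ (+ k) q c ℚ.* ℕtoℚ t'
ℕtoℚ-≤-mkℚ* {k} {q} {c} t t' t*q≤k*t' = ℚ.toℚᵘ-cancel-≤ (begin
  ℚ.toℚᵘ (ℕtoℚ t)
    ≃⟨ ℚ.toℚᵘ-fromℚᵘ (mkℚᵘ (+ t) 0) ⟩
  mkℚᵘ (+ t) 0
    ≤⟨ mkℚᵘ-+-≤⁺ (subst (t * suc q ≤_) (sym (*-identityʳ (k * t'))) t*q≤k*t') ⟩
  mkℚᵘ (+ (k * t')) q
    ≃⟨ *≡* (cong₂ ℤ._*_ (ℤ.pos-* k t') (cong (λ n → + suc n) (*-identityʳ q))) ⟩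
  mkℚᵘ (+ k) q ℚᵘ.* mkℚᵘ (+ t') 0
    ≃⟨ ℚᵘ.*-congˡ {mkℚᵘ (+ k) q} (ℚ.toℚᵘ-fromℚᵘ (mkℚᵘ (+ t') 0)) ⟨
  mkℚᵘ (+ k) q ℚᵘ.* ℚ.toℚᵘ (ℕtoℚ t')
    ≃⟨ ℚ.toℚᵘ-homo-* (mkℚ (+ k) q c) (ℕtoℚ t') ⟨
  ℚ.toℚᵘ (mkℚ (+ k) q c ℚ.* ℕtoℚ t')
    ∎)
  where open ℚᵘ.≤-Reasoning

ratio-nonNeg : (a b : ℕ) → ℚ.NonNegative (ratio a b)
ratio-nonNeg a 0       = _
ratio-nonNeg a (suc b) = ℚ.normalize-nonNeg a (suc b)

module _ {G G' : Graph} {τ : Vertex G → Vertex G'}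
         {d : Vertex G → Vertex G → ℕ} {d' : Vertex G' → Vertex G' → ℕ} where

  lipNorm-nonNeg : {L : ℚ} → IsLipNormInv G G' τ d d' L → ℚ.NonNegative L
  lipNorm-nonNeg (_ , inj₁ (x₁ , x₂ , _ , refl)) = ratio-nonNeg (d x₁ x₂) (d' (τ x₁) (τ x₂))
  lipNorm-nonNeg (_ , inj₂ (_ , refl))           = _

  lipNorm-bound : Injective _≡_ _≡_ τ → IsShortestPathMetric G d → IsShortestPathMetric G' d' →
                  ∀ {k q} .{c : Coprime k (suc q)} → IsLipNormInv G G' τ d d' (mkℚ (+ k) q c) →
                  ∀ x₁ x₂ → d x₁ x₂ * suc q ≤ k * d' (τ x₁) (τ x₂)
  lipNorm-bound τ-inj spm spm' (ratio≤L , _) x₁ x₂ with x₁ Fin.≟ x₂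
  ... | yes refl = subst (λ m → m * _ ≤ _) (sym (ShortestPath.d-refl spm x₁)) z≤n
  ... | no x₁≢x₂ with d' (τ x₁) (τ x₂) in d'≡
  ...   | 0     = ⊥-elim (x₁≢x₂ (τ-inj (ShortestPath.d≡0⇒≡ spm' d'≡)))
  ...   | suc b = ratio-≤-mkℚ⇒ (d x₁ x₂) b
                    (subst (λ m → ratio (d x₁ x₂) m ℚ.≤ _) d'≡ (ratio≤L x₁ x₂ x₁≢x₂))

lemma10 : (G G' : Graph) (τ : Vertex G → Vertex G') → Injective _≡_ _≡_ τ →
          (d : Vertex G → Vertex G → ℕ) (d' : Vertex G' → Vertex G' → ℕ) →
          IsShortestPathMetric G d → IsShortestPathMetric G' d' →
          (S : Subset (Graph.n G)) (L : ℚ) (t t' : ℕ) →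
          IsLipNormInv G G' τ d d' L →
          IsTour G (λ v → v ∈ S) t → IsTour G' (Image {G} {G'} τ S) t' →
          ℕtoℚ t ℚ.≤ L ℚ.* ℕtoℚ t'
lemma10 G G' τ τ-inj d d' spm spm' S (mkℚ -[1+ _ ] _ _) t t' lip _ _ =
  ⊥-elim (ℤ.NonNegative.nonNeg (lipNorm-nonNeg {G} {G'} {τ} {d} {d'} lip))
lemma10 G G' τ τ-inj d d' spm spm' S (mkℚ (+ k) q _) t t' lip tour tour' =
  ℕtoℚ-≤-mkℚ* t t' (Lifting.tour-bound G G' τ τ-inj spm spm' (suc q) k
                 (lipNorm-bound τ-inj spm spm' lip) S tour tour')
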